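{- Consider a discrete-time control system $x_{t+1}=f(x_t,u_t,w_t)$ with state $x_t\in\mathbb{X}\subset\mathbb{R}^n$, noise $w_t\in\mathbb{W}$, and control $u_t=[u_t^0,\ldots,u_t^{m-1}]\in\mathbb{U}=\mathbb{U}^0\times\cdots\times\mathbb{U}^{m-1}$, where each $\mathbb{U}^j\subset\mathbb{R}$ is finite and satisfies $|\mathbb{U}^j|\ge 2$ for every $j=0,\ldots,m-1$. Let $$\Psi=\Phi_1\vee\cdots\vee\Phi_p,\qquad \Phi_i=\big(G^-_{[1,b_i]}\, u^{j_i}=c_i\big)\wedge\big(F^-_{[1,1]}\,\phi_i\big),$$ where for each $i$, $j_i\in\{0,\ldots,m-1\}$, $c_i\in\mathbb{R}$, $\phi_i$ is an arbitrary ptSTL formula over the state and control variables, and $b_i\ge 2$. Let $k\ge 1$, let $(x_0,u_0),\ldots,(x_{k-1},u_{k-1})$ be a trace of the system and $x_k$ the current state. Consider the following controller: initialize a candidate set $C:=\mathbb{U}$; while $C\neq\emptyset$, pick $u\in C$ arbitrarily (randomly); if the trace $(x_0,u_0),\ldots,(x_{k-1},u_{k-1}),(x_k,u)$ satisfies at time $k$ the formula $\big(G^-_{[0,b_i-1]}\,u^{j_i}=c_i\big)\wedge\phi_i$ for some $i\in\{1,\ldots,p\}$, remove $u$ from $C$; otherwise output $u_k:=u$; if $C$ becomes empty, output an arbitrary element of $\mathbb{U}$. Then the control $u_k$ generated by this controller guarantees that $\Psi$ is violated at time step $k+1$: for every $x_{k+1}\in\mathbb{X}$ and $u_{k+1}\in\mathbb{U}$,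 the trace $(x_0,u_0),\ldots,(x_k,u_k),(x_{k+1},u_{k+1})$ does not satisfy $\Psi$ at time $k+1$.
   Context: A trace is a finite sequence $\mathbf{x}=(x_0,u_0),\ldots,(x_N,u_N)$. Past-time Signal Temporal Logic (ptSTL) formulas are built by $\phi::= true\mid x^i\sim c\mid u^i=c\mid\neg\phi\mid\phi_1\wedge\phi_2\mid\phi_1\, S_{[a,b]}\,\phi_2$ with $\sim\in\{<,>\}$, $c\in\mathbb{R}$, $a\le b$. Satisfaction at time $k$: $(\mathbf{x},k)\models x^i\sim c$ iff $x_k^i\sim c$; $(\mathbf{x},k)\models u^i=c$ iff $u^i_k=c$; negation and conjunction as usual; $(\mathbf{x},k)\models\phi_1 S_{[a,b]}\phi_2$ iff there exists $j\in[k-b,k-a]\cap[0,k]$ with $(\mathbf{x},j)\models\phi_2$ and $(\mathbf{x},l)\models\phi_1$ for all $l\in[j,k]$. Derived operators: $F^-_{[a,b]}\phi:=true\, S_{[a,b]}\,\phi$ ("previously") and $G^-_{[a,b]}\phi:=\neg F^-_{[a,b]}\neg\phi$ ("always in the past"). Disjunction is $\phi_1\vee\phi_2:=\neg(\neg\phi_1\wedge\neg\phi_2)$. -}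

module Defs where

open import Data.Nat using (ℕ; zero; suc; _+_; _∸_; _≤_; _<_; _≡ᵇ_)
open import Data.Fin using (Fin)
open import Data.Vec using (Vec; lookup)
open import Data.List using (List; []; _∷_; map)
open import Data.List.Membership.Propositional using (_∈_)
open import Data.Fin using ()
open import Data.List using (allFin)
open import Data.Bool using (if_then_else_)
open import Data.Product using (Σ; _×_; ∃)
open import Data.Unit using (⊤)
open import Relation.Nullary using (¬_)
open import Relation.Binary.PropositionalEquality using (_≡_; _≢_)

data Form (R : Set) (n m : ℕ) : Set where
  true  : Form R n m
  xlt   : Fin n → R → Form R n m
  xgt   : Fin n → R → Form R n m
  ueq   : Fin m → R → Form R n m
  ¬'_   : Form R n m → Form R n m
  _∧'_  : Form R n m → Form R n m → Form R n m
  S[_,_] : ℕ → ℕ → Form R n m → Form R n m → Form R n m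

module _ {R : Set} {n m : ℕ} where

  F⁻ : ℕ → ℕ → Form R n m → Form R n m
  F⁻ a b φ = S[ a , b ] true φ

  G⁻ : ℕ → ℕ → Form R n m → Form R n m
  G⁻ a b φ = ¬' F⁻ a b (¬' φ)

  _∨'_ : Form R n m → Form R n m → Form R n m
  φ ∨' ψ = ¬' ((¬' φ) ∧' (¬' ψ))

  ⋁ : List (Form R n m) → Form R n m
  ⋁ [] = ¬' true
  ⋁ (φ ∷ []) = φ
  ⋁ (φ ∷ ψs) = φ ∨' ⋁ ψs

-- Traces: xs t = x_t, us t = u_t.  Satisfaction at time k only inspects
-- times 0..k, so a finite trace (x_0,u_0),...,(x_N,u_N) is represented by
-- any pair of functions agreeing with it on 0..N.
Sat : {R : Set} {n m : ℕ} (_<ᴿ_ : R → R → Set) →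
      (ℕ → Vec R n) → (ℕ → Vec R m) → ℕ → Form R n m → Set
Sat _<ᴿ_ xs us k true = ⊤
Sat _<ᴿ_ xs us k (xlt i c) = lookup (xs k) i <ᴿ c
Sat _<ᴿ_ xs us k (xgt i c) = c <ᴿ lookup (xs k) i
Sat _<ᴿ_ xs us k (ueq i c) = lookup (us k) i ≡ c
Sat _<ᴿ_ xs us k (¬' φ) = ¬ Sat _<ᴿ_ xs us k φ
Sat _<ᴿ_ xs us k (φ ∧' ψ) = Sat _<ᴿ_ xs us k φ × Sat _<ᴿ_ xs us k ψ
Sat _<ᴿ_ xs us k (S[ a , b ] φ ψ) =
  Σ ℕ λ j → (j + a ≤ k) × (k ≤ j + b) × Sat _<ᴿ_ xs us j ψ ×
            (∀ l → j ≤ l → l ≤ k → Sat _<ᴿ_ xs us l φ)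

upd : {A : Set} → (ℕ → A) → ℕ → A → ℕ → A
upd f k v t = if t ≡ᵇ k then v else f t

InU : {R : Set} {m : ℕ} → (Fin m → List R) → Vec R m → Set
InU Us v = ∀ j → lookup v j ∈ Us j

AtLeastTwo : {R : Set} → List R → Set
AtLeastTwo L = Σ _ λ a → Σ _ λ b → a ∈ L × b ∈ L × a ≢ b

-- the nondeterministic controller, as the relation "Ctrl Bad U C u":
-- starting from candidate set C, the loop can terminate with output u.
-- Bad v: the extended trace with control v at time k satisfies some
-- (G⁻[0,b_i-1] u^{j_i}=c_i) ∧ φ_i at time k.
data Ctrl {A : Set} (Bad : A → Set) (U : A → Set) : (A → Set) → A → Set₁ where
  accept : ∀ {C u} → C u → ¬ Bad u → Ctrl Bad U C u
  reject : ∀ {C u u'} → C u → Bad u →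
           Ctrl Bad U (λ v → C v × v ≢ u) u' → Ctrl Bad U C u'
  empty  : ∀ {C u} → (∀ v → ¬ C v) → U u → Ctrl Bad U C u

-- If Φ_i holds at time k+1 then (G⁻[0,b_i-1] u^{j_i} = c_i) ∧ φ_i holds at time k, and
-- satisfaction at time k does not see step k+1; so Ψ is violated at k+1 as soon as the
-- chosen u_k is not rejected by the controller. The loop only discards rejected candidates,
-- so it outputs a non-rejected one whenever such a candidate exists in U. Since |U^j| ≥ 2
-- there is a v ∈ U with v^j ≠ u^j_{k-1} for every j, and since b_i ≥ 2 the window of
-- G⁻[0,b_i-1] contains both k-1 and k, forcing u^{j_i}_k = c_i = u^{j_i}_{k-1}: so v is
-- never rejected. Without decidable equality on the values, v only exists under a double
-- negation, which suffices because the conclusion is a negation.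
module Submission where

open import Defs
open import Data.Nat using (ℕ; zero; suc; _+_; _∸_; _≤_; _<_; _≡ᵇ_; z≤n; s≤s)
open import Data.Nat.Properties
  using ( ≡ᵇ⇒≡; ≤-refl; ≤-reflexive; ≤-trans; ≤-antisym; <⇒≤; <⇒≢; suc-injective
        ; m≤n⇒m≤1+n; m≤m+n; m<m+n; m+n≤o⇒m≤o; +-identityʳ; +-suc; +-comm )
open import Data.Fin using (Fin) renaming (zero to fzero; suc to fsuc)
open import Data.Vec using (Vec; lookup; tabulate)
open import Data.Vec.Properties using (lookup∘tabulate)
open import Data.List using (List; []; _∷_; map; allFin)
open import Data.List.Membership.Propositional using (_∈_)
open import Data.List.Relation.Unary.All using (All; []; _∷_)
open import Data.List.Relation.Unary.All.Properties using (map⁺; tabulate⁺)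
open import Data.Bool using (true; false; T)
open import Data.Product using (Σ; _×_; _,_; proj₁; proj₂)
open import Data.Unit using (tt)
open import Data.Empty using (⊥-elim)
open import Function using (_∘_)
open import Relation.Nullary using (¬_)
open import Relation.Binary.PropositionalEquality
  using (_≡_; _≢_; refl; sym; trans; subst; subst₂)

upd-≡ : {A : Set} (f : ℕ → A) (k : ℕ) (v : A) → upd f k v k ≡ v
upd-≡ f zero    v = refl
upd-≡ f (suc k) v = upd-≡ (f ∘ suc) k v   -- suc k ≡ᵇ suc k reduces to k ≡ᵇ k

upd-≢ : {A : Set} (f : ℕ → A) (k : ℕ) (v : A) {t : ℕ} → t ≢ k → upd f k v t ≡ f t
upd-≢ f k v {t} t≢k with t ≡ᵇ k in eq
... | true  = ⊥-elim (t≢k (≡ᵇ⇒≡ t k (subst T (sym eq) tt)))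
... | false = refl

Agree : {A : Set} → ℕ → (ℕ → A) → (ℕ → A) → Set
Agree k f g = ∀ {t} → t ≤ k → f t ≡ g t

Agree-sym : {A : Set} {k : ℕ} {f g : ℕ → A} → Agree k f g → Agree k g f
Agree-sym f≈g t≤k = sym (f≈g t≤k)

Agree-≤ : {A : Set} {j k : ℕ} {f g : ℕ → A} → j ≤ k → Agree k f g → Agree j f g
Agree-≤ j≤k f≈g t≤j = f≈g (≤-trans t≤j j≤k)

upd-future-Agree : {A : Set} (f : ℕ → A) (k : ℕ) (v : A) → Agree k (upd f (suc k) v) f
upd-future-Agree f k v t≤k = upd-≢ f (suc k) v (<⇒≢ (s≤s t≤k))

¬¬-pull-Fin : ∀ m {P : Fin m → Set} → (∀ j → ¬ ¬ P j) → ¬ ¬ (∀ j → P j)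
¬¬-pull-Fin zero    ¬¬P ¬∀P = ¬∀P λ ()
¬¬-pull-Fin (suc m) ¬¬P ¬∀P =
  ¬¬P fzero λ P0 → ¬¬-pull-Fin m (¬¬P ∘ fsuc) λ P+ →
    ¬∀P λ { fzero → P0 ; (fsuc j) → P+ j }

AtLeastTwo⇒¬¬∃≢ : {R : Set} {L : List R} → AtLeastTwo L → (w : R) → ¬ ¬ (Σ R λ r → r ∈ L × r ≢ w)
AtLeastTwo⇒¬¬∃≢ (a , b , a∈L , b∈L , a≢b) w ¬∃ =
  ¬∃ (a , a∈L , λ a≡w → ¬∃ (b , b∈L , λ b≡w → a≢b (trans a≡w (sym b≡w))))

module _ {R : Set} {m : ℕ} {Us : Fin m → List R} where

  ¬¬switching-control : (∀ j → AtLeastTwo (Us j)) → (w : Vec R m) →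
                        ¬ ¬ (Σ (Vec R m) λ v → InU Us v × ∀ j → lookup v j ≢ lookup w j)
  ¬¬switching-control two w ¬∃ =
    ¬¬-pull-Fin m (λ j → AtLeastTwo⇒¬¬∃≢ (two j) (lookup w j)) λ choice →
      let v = tabulate (proj₁ ∘ choice)
          v-at : ∀ j → lookup v j ≡ proj₁ (choice j)
          v-at = lookup∘tabulate (proj₁ ∘ choice)
      in ¬∃ ( v
            , (λ j → subst (_∈ Us j) (sym (v-at j)) (proj₁ (proj₂ (choice j))))
            , (λ j → proj₂ (proj₂ (choice j)) ∘ trans (sym (v-at j))) )

module _ {A : Set} {Bad U : A → Set} where

  Ctrl⇒¬Bad : ∀ {C u v} → Ctrl Bad U C u → C v → ¬ Bad v → ¬ Bad u
  Ctrl⇒¬Bad (accept _ ¬Bad-u)      _  _      = ¬Bad-u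
  Ctrl⇒¬Bad (reject _ Bad-u' rest) Cv ¬Bad-v =
    Ctrl⇒¬Bad rest (Cv , λ { refl → ¬Bad-v Bad-u' }) ¬Bad-v
  Ctrl⇒¬Bad (empty C-empty _)      Cv _      = ⊥-elim (C-empty _ Cv)

module _ {R : Set} {_<ᴿ_ : R → R → Set} {n m : ℕ} where

  Sat-Agree : (φ : Form R n m) {k : ℕ} {xs xs' : ℕ → Vec R n} {us us' : ℕ → Vec R m} →
              Agree k xs xs' → Agree k us us' → Sat _<ᴿ_ xs us k φ → Sat _<ᴿ_ xs' us' k φ
  Sat-Agree true        xs≈ us≈ _ = tt
  Sat-Agree (xlt i c)   xs≈ us≈ s = subst (λ x → lookup x i <ᴿ c) (xs≈ ≤-refl) s
  Sat-Agree (xgt i c)   xs≈ us≈ s = subst (λ x → c <ᴿ lookup x i) (xs≈ ≤-refl) s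
  Sat-Agree (ueq i c)   xs≈ us≈ s = subst (λ u → lookup u i ≡ c) (us≈ ≤-refl) s
  Sat-Agree (¬' φ)      xs≈ us≈ ¬s s' = ¬s (Sat-Agree φ (Agree-sym xs≈) (Agree-sym us≈) s')
  Sat-Agree (φ ∧' ψ)    xs≈ us≈ (sφ , sψ) = Sat-Agree φ xs≈ us≈ sφ , Sat-Agree ψ xs≈ us≈ sψ
  Sat-Agree (S[ a , b ] φ ψ) xs≈ us≈ (j , j+a≤k , k≤j+b , sψ , sφ) =
    j , j+a≤k , k≤j+b ,
    Sat-Agree ψ (Agree-≤ j≤k xs≈) (Agree-≤ j≤k us≈) sψ ,
    λ l j≤l l≤k → Sat-Agree φ (Agree-≤ l≤k xs≈) (Agree-≤ l≤k us≈) (sφ l j≤l l≤k)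
    where j≤k = m+n≤o⇒m≤o j j+a≤k

  module _ {xs : ℕ → Vec R n} {us : ℕ → Vec R m} where

    private
      Holds : ℕ → Form R n m → Set
      Holds = Sat _<ᴿ_ xs us

    ⋁-unsat : ∀ {k} {φs : List (Form R n m)} →
              All (λ φ → ¬ Holds k φ) φs → ¬ Holds k (⋁ φs)
    ⋁-unsat []               s = s tt
    ⋁-unsat (¬sφ ∷ [])       s = ¬sφ s
    ⋁-unsat (¬sφ ∷ ¬sψ ∷ ¬s) s = s (¬sφ , ⋁-unsat (¬sψ ∷ ¬s))

    F⁻-suc : ∀ {k a b} (φ : Form R n m) →
             Holds k (F⁻ a b φ) → Holds (suc k) (F⁻ (suc a) (suc b) φ)
    F⁻-suc {k = k} {a} {b} φ (j , j+a≤k , k≤j+b , sφ , _) =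
      j , subst (_≤ suc k) (sym (+-suc j a)) (s≤s j+a≤k) ,
          subst (suc k ≤_) (sym (+-suc j b)) (s≤s k≤j+b) , sφ , λ _ _ _ → tt

    G⁻-pred : ∀ {k a b} (φ : Form R n m) →
              Holds (suc k) (G⁻ (suc a) (suc b) φ) → Holds k (G⁻ a b φ)
    G⁻-pred φ g f = g (F⁻-suc (¬' φ) f)

    F⁻₁₁-pred : ∀ {k} (φ : Form R n m) → Holds (suc k) (F⁻ 1 1 φ) → Holds k φ
    F⁻₁₁-pred {k = k} φ (j , j+1≤1+k , 1+k≤j+1 , sφ , _) = subst (λ t → Holds t φ) j≡k sφ
      where
        j≡k : j ≡ k
        j≡k = suc-injective (≤-antisym (subst (_≤ suc k) (+-comm j 1) j+1≤1+k)
                                        (subst (suc k ≤_) (+-comm j 1) 1+k≤j+1))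

    G⁻-elim : ∀ {k a b} (φ : Form R n m) (t : ℕ) →
              t + a ≤ k → k ≤ t + b → Holds k (G⁻ a b φ) → ¬ ¬ Holds t φ
    G⁻-elim φ t t+a≤k k≤t+b g ¬sφ = g (t , t+a≤k , k≤t+b , ¬sφ , λ _ _ _ → tt)

    G⁻₀-ueq⇒¬¬repeat : ∀ {k b j c} → 2 ≤ b →
                       Holds (suc k) (G⁻ 0 (b ∸ 1) (ueq j c)) →
                       ¬ ¬ (lookup (us (suc k)) j ≡ lookup (us k) j)
    G⁻₀-ueq⇒¬¬repeat {k = k} {suc (suc b)} {j} {c} (s≤s (s≤s z≤n)) g ¬repeat =
      G⁻-elim (ueq j c) (suc k) (≤-reflexive (+-identityʳ (suc k))) (m≤m+n (suc k) _) g λ now≡c →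
      G⁻-elim (ueq j c) k (m≤n⇒m≤1+n (≤-reflexive (+-identityʳ k))) (m<m+n k (s≤s z≤n)) g λ before≡c →
      ¬repeat (trans now≡c (sym before≡c))

    Φ-pred : ∀ {k b j c} (φ : Form R n m) → 1 ≤ b →
             Holds (suc k) (G⁻ 1 b (ueq j c) ∧' F⁻ 1 1 φ) →
             Holds k (G⁻ 0 (b ∸ 1) (ueq j c) ∧' φ)
    Φ-pred φ (s≤s z≤n) (g , f) = G⁻-pred (ueq _ _) g , F⁻₁₁-pred φ f

proposition1 : (R : Set) (_<ᴿ_ : R → R → Set) (n m : ℕ)
    -- system x_{t+1} = f(x_t,u_t,w_t), state set X, noise set W
    (X : Vec R n → Set) (W : Set) (f : Vec R n → Vec R m → W → Vec R n)
    -- finite control sets U^j with |U^j| ≥ 2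
    (Us : Fin m → List R) → (∀ j → AtLeastTwo (Us j)) →
    -- the specification Ψ = Φ_1 ∨ ... ∨ Φ_p
    (p : ℕ) → 1 ≤ p →
    (js : Fin p → Fin m) (cs : Fin p → R) (φs : Fin p → Form R n m) (bs : Fin p → ℕ) →
    (∀ i → 2 ≤ bs i) →
    -- trace (x_0,u_0),...,(x_{k-1},u_{k-1}) of the system and current state x_k
    (k : ℕ) → 1 ≤ k →
    (xs : ℕ → Vec R n) (us : ℕ → Vec R m) →
    (∀ t → t < k → X (xs t) × InU Us (us t) × Σ W λ w → xs (suc t) ≡ f (xs t) (us t) w) →
    X (xs k) →
    -- any output u of the controller
    (u : Vec R m) →
    Ctrl (λ v → Σ (Fin p) λ i →
                  Sat _<ᴿ_ xs (upd us k v) k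
                    (G⁻ 0 (bs i ∸ 1) (ueq (js i) (cs i)) ∧' φs i))
         (InU Us) (InU Us) u →
    -- Ψ is violated at time k+1
    (x' : Vec R n) → X x' → (u' : Vec R m) → InU Us u' →
    ¬ Sat _<ᴿ_ (upd xs (suc k) x') (upd (upd us k u) (suc k) u') (suc k)
        (⋁ (map (λ i → G⁻ 1 (bs i) (ueq (js i) (cs i)) ∧' F⁻ 1 1 (φs i)) (allFin p)))
proposition1 R _<ᴿ_ n m _ _ _ Us two p _ js cs φs bs b≥2 (suc k) _ xs us _ _ u ctrl x' _ u' _ Ψ-holds =
  ¬¬switching-control two (us k) λ (v , v∈U , v-switches) →
  ⋁-unsat (map⁺ (tabulate⁺ (Φ-unsat (Ctrl⇒¬Bad ctrl v∈U (switching-¬Bad v v-switches))))) Ψ-holds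
  where
    Bad : Vec R m → Set
    Bad v = Σ (Fin p) λ i → Sat _<ᴿ_ xs (upd us (suc k) v) (suc k)
                              (G⁻ 0 (bs i ∸ 1) (ueq (js i) (cs i)) ∧' φs i)

    switching-¬Bad : ∀ v → (∀ j → lookup v j ≢ lookup (us k) j) → ¬ Bad v
    switching-¬Bad v v-switches (i , g , _) =
      G⁻₀-ueq⇒¬¬repeat {_<ᴿ_ = _<ᴿ_} {xs = xs} {us = upd us (suc k) v} (b≥2 i) g λ repeat →
        v-switches (js i) (subst₂ (λ a b → lookup a (js i) ≡ lookup b (js i))
                                  (upd-≡ us (suc k) v) (upd-future-Agree us k v ≤-refl) repeat)

    Φ-unsat : ¬ Bad u → ∀ i →
              ¬ Sat _<ᴿ_ (upd xs (suc (suc k)) x') (upd (upd us (suc k) u) (suc (suc k)) u') (suc (suc k))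
                  (G⁻ 1 (bs i) (ueq (js i) (cs i)) ∧' F⁻ 1 1 (φs i))
    Φ-unsat ¬Bad-u i sΦ =
      ¬Bad-u (i , Sat-Agree (G⁻ 0 (bs i ∸ 1) (ueq (js i) (cs i)) ∧' φs i)
                            (upd-future-Agree xs (suc k) x') (upd-future-Agree (upd us (suc k) u) (suc k) u')
                            (Φ-pred (φs i) (<⇒≤ (b≥2 i)) sΦ))
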